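{- Let $\mathscr{L}$ be a language with semantic structure $\mathcal{S}=(\Sigma,I)$, and suppose $\mathscr{L}$ is closed under infinite logical conjunction. Let $\mathcal{S}^\sharp = (\mathrm{AD}_{\mathscr{L}}, I^\sharp)$ be an abstract semantic structure on the abstract domain $\mathrm{AD}_{\mathscr{L}}$. If the abstract semantics $[\![\cdot]\!]_{\mathcal{S}^\sharp}$ is strongly preserving for $\mathscr{L}$, then $I^\sharp = I^{\mathrm{AD}_{\mathscr{L}}}$.
   Context: A language $\mathscr{L}$: formulas $\varphi ::= p \mid f(\varphi_1,\dots,\varphi_n)$, $p\in AP$, $f\in Op$ finite with arities $>0$; $\mathcal{S}=(\Sigma,I)$ gives $I(p)\subseteq\Sigma$, $I(f):\wp(\Sigma)^n\to\wp(\Sigma)$ and the inductive concrete semantics $[\![\cdot]\!]_{\mathcal{S}}$. $\mathscr{L}$ is closed under infinite logical conjunction if for every $\Phi\subseteq\mathscr{L}$ there is $\psi\in\mathscr{L}$ with $\bigcap_{\varphi\in\Phi}[\![\varphi]\!]_{\mathcal{S}}=[\![\psi]\!]_{\mathcal{S}}$ (for $\Phi=\varnothing$ this intersection is $\Sigma$). $\mathrm{AD}_{\mathscr{L}}$ is the set of all intersections of families of sets $[\![\varphi]\!]_{\mathcal{S}}$, $\varphi\in\mathscr{L}$, viewed as an abstract domain of $\wp(\Sigma)_\subseteq$ with $\gamma$ the inclusion and $\alpha(S)=\bigcap\{X\in\mathrm{AD}_{\mathscr{L}}\mid S\subseteq X\}$. An abstract semantic structure $(A,I^\sharp)$ on an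 abstract domain $A$ (Galois insertion $(\alpha,\wp(\Sigma),A,\gamma)$) gives $I^\sharp(p)\in A$, $I^\sharp(f):A^n\to A$ and the inductive abstract semantics $[\![\cdot]\!]_{\mathcal{S}^\sharp}$; it is strongly preserving if for all $\varphi$, $S\subseteq\Sigma$: $\alpha(S)\le_A[\![\varphi]\!]_{\mathcal{S}^\sharp}\iff S\subseteq[\![\varphi]\!]_{\mathcal{S}}$. $I^A$ denotes the best correct approximation interpretation on $A$: $I^A(p)=\alpha(I(p))$, $I^A(f)(a_1,\dots,a_n)=\alpha(I(f)(\gamma(a_1),\dots,\gamma(a_n)))$. -}

module Defs where

open import Data.Nat using (ℕ; _<_)
open import Data.Fin using (Fin)
open import Data.Product using (_×_; ∃)

Pred : Set → Set₁
Pred A = A → Set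

_⊆_ : {A : Set} → Pred A → Pred A → Set
X ⊆ Y = ∀ s → X s → Y s

_≐_ : {A : Set} → Pred A → Pred A → Set
X ≐ Y = (X ⊆ Y) × (Y ⊆ X)

record Language : Set₁ where
  field
    AP        : Set
    nOp       : ℕ
    arity     : Fin nOp → ℕ
    arity-pos : ∀ f → 0 < arity f

open Language public

data Formula (L : Language) : Set where
  atom : AP L → Formula L
  app  : (f : Fin (nOp L)) → (Fin (arity L f) → Formula L) → Formula L

-- A semantic structure S = (Σ, I).  I(f) is a function on ℘(Σ)^n; since
-- subsets are represented by predicates, it is required to respect
-- extensional equality of subsets.
record SemStr (L : Language) : Set₁ where
  field
    St     : Set
    I-atom : AP L → Pred St
    I-op   : (f : Fin (nOp L)) → (Fin (arity L f) → Pred St) → Pred St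
    I-op-cong : ∀ f (xs ys : Fin (arity L f) → Pred St) →
                (∀ i → xs i ≐ ys i) → I-op f xs ≐ I-op f ys

module _ {L : Language} (S : SemStr L) where
  open SemStr S

  sem : Formula L → Pred St
  sem (atom p)     = I-atom p
  sem (app f args) = I-op f (λ i → sem (args i))

  ⋂ : (Formula L → Set) → Pred St
  ⋂ Φ s = ∀ φ → Φ φ → sem φ s

  ClosedUnderInfConj : Set₁
  ClosedUnderInfConj = ∀ (Φ : Formula L → Set) → ∃ λ ψ → ⋂ Φ ≐ sem ψ

  -- The abstract domain AD_L: an element is represented by a family Φ of
  -- formulas, standing for the set ⋂ Φ.  γ is the inclusion.
  AD : Set₁
  AD = Formula L → Set

  γ : AD → Pred St
  γ = ⋂

  _≤A_ : AD → AD → Set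
  a ≤A b = γ a ⊆ γ b

  _≈A_ : AD → AD → Set
  a ≈A b = γ a ≐ γ b

  -- α(S) = ⋂{X ∈ AD_L | S ⊆ X}, presented (predicatively) as the
  -- intersection of all generators [[φ]] containing S.
  α : Pred St → AD
  α X φ = X ⊆ sem φ

  -- An abstract semantic structure on AD_L (operations respect ≈A, i.e. are
  -- genuine functions on AD_L).
  record AbsSemStr : Set₁ where
    field
      I♯-atom : AP L → AD
      I♯-op   : (f : Fin (nOp L)) → (Fin (arity L f) → AD) → AD
      I♯-op-cong : ∀ f (as bs : Fin (arity L f) → AD) →
                   (∀ i → as i ≈A bs i) → I♯-op f as ≈A I♯-op f bs

  module _ (S♯ : AbsSemStr) where
    open AbsSemStr S♯

    sem♯ : Formula L → AD
    sem♯ (atom p)     = I♯-atom p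
    sem♯ (app f args) = I♯-op f (λ i → sem♯ (args i))

    StronglyPreserving : Set₁
    StronglyPreserving = ∀ (φ : Formula L) (X : Pred St) →
      ((α X ≤A sem♯ φ) → X ⊆ sem φ) × (X ⊆ sem φ → α X ≤A sem♯ φ)

    IsBestCorrectApprox : Set₁
    IsBestCorrectApprox =
      (∀ p → I♯-atom p ≈A α (I-atom p)) ×
      (∀ f (as : Fin (arity L f) → AD) →
         I♯-op f as ≈A α (I-op f (λ i → γ (as i))))

{-# OPTIONS --safe #-}
module Submission where

-- Strong preservation, tested at X = γ ⟦φ⟧♯ and at X = ⟦φ⟧, forces γ ⟦φ⟧♯ = ⟦φ⟧
-- for every formula φ.  Closure under infinite conjunction makes every abstract
-- element the denotation of a formula, so I♯(f) applied to arbitrary arguments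
-- is the abstract semantics of a formula f(ψ₁,…,ψₙ), whose concretisation is
-- therefore I(f)(γ a₁,…,γ aₙ).  Since γ ∘ α is the identity on AD, I♯ agrees
-- with α ∘ I ∘ γ.

open import Defs
open import Data.Fin using (Fin)
open import Data.Product using (_,_; proj₁; proj₂)
open import Function using (_∘_; id)
open import Level using (0ℓ) renaming (suc to lsuc)
open import Relation.Binary.Bundles using (Setoid)
import Relation.Binary.Reasoning.Setoid as SetoidReasoning

≐-refl : {A : Set} {X : Pred A} → X ≐ X
≐-refl = (λ _ → id) , (λ _ → id)

≐-sym : {A : Set} {X Y : Pred A} → X ≐ Y → Y ≐ X
≐-sym (X⊆Y , Y⊆X) = Y⊆X , X⊆Y

≐-trans : {A : Set} {X Y Z : Pred A} → X ≐ Y → Y ≐ Z → X ≐ Z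
≐-trans (X⊆Y , Y⊆X) (Y⊆Z , Z⊆Y) = (λ s → Y⊆Z s ∘ X⊆Y s) , (λ s → Y⊆X s ∘ Z⊆Y s)

≐-setoid : Set → Setoid (lsuc 0ℓ) 0ℓ
≐-setoid A = record
  { Carrier       = Pred A
  ; _≈_           = _≐_
  ; isEquivalence = record { refl = ≐-refl ; sym = ≐-sym ; trans = ≐-trans }
  }

module _ {L : Language} (S : SemStr L) where
  open SemStr S

  γ∘α-extensive : (X : Pred St) → X ⊆ γ S (α S X)
  γ∘α-extensive X s s∈X φ X⊆⟦φ⟧ = X⊆⟦φ⟧ s s∈X

  γ∘α-fixes-AD : (a : AD S) {X : Pred St} → X ≐ γ S a → γ S (α S X) ≐ X
  γ∘α-fixes-AD a {X} (X⊆γa , γa⊆X) =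
    (λ s s∈γαX → γa⊆X s (λ φ φ∈a → s∈γαX φ (λ t t∈X → X⊆γa t t∈X φ φ∈a))) ,
    γ∘α-extensive X

  γ≐⇒≈A-α : (a : AD S) {X : Pred St} → γ S a ≐ X → _≈A_ S a (α S X)
  γ≐⇒≈A-α a γa≐X = ≐-trans γa≐X (≐-sym (γ∘α-fixes-AD a (≐-sym γa≐X)))

  module _ (S♯ : AbsSemStr S) (sp : StronglyPreserving S S♯) where
    open AbsSemStr S♯

    γ∘sem♯≐sem : (φ : Formula L) → γ S (sem♯ S S♯ φ) ≐ sem S φ
    γ∘sem♯≐sem φ = sound , complete
      where
      sound : γ S (sem♯ S S♯ φ) ⊆ sem S φ
      sound = proj₁ (sp φ (γ S (sem♯ S S♯ φ)))
                    (proj₁ (γ∘α-fixes-AD (sem♯ S S♯ φ) ≐-refl))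

      complete : sem S φ ⊆ γ S (sem♯ S S♯ φ)
      complete s = proj₂ (sp φ (sem S φ)) (λ _ → id) s ∘ γ∘α-extensive (sem S φ) s

    γ∘I♯-op≐I-op∘γ : ClosedUnderInfConj S → ∀ f (as : Fin (arity L f) → AD S) →
                     γ S (I♯-op f as) ≐ I-op f (γ S ∘ as)
    γ∘I♯-op≐I-op∘γ cl f as = begin
      γ S (I♯-op f as)          ≈⟨ I♯-op-cong f as (sem♯ S S♯ ∘ ψ) as≈sem♯ψ ⟩
      γ S (sem♯ S S♯ (app f ψ)) ≈⟨ γ∘sem♯≐sem (app f ψ) ⟩
      sem S (app f ψ)           ≈⟨ I-op-cong f (sem S ∘ ψ) (γ S ∘ as) (≐-sym ∘ γas≐semψ) ⟩
      I-op f (γ S ∘ as)         ∎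
      where
      open SetoidReasoning (≐-setoid St)

      ψ : Fin (arity L f) → Formula L
      ψ i = proj₁ (cl (as i))

      γas≐semψ : ∀ i → γ S (as i) ≐ sem S (ψ i)
      γas≐semψ i = proj₂ (cl (as i))

      as≈sem♯ψ : ∀ i → _≈A_ S (as i) (sem♯ S S♯ (ψ i))
      as≈sem♯ψ i = ≐-trans (γas≐semψ i) (≐-sym (γ∘sem♯≐sem (ψ i)))

theorem5p9 : (L : Language) (S : SemStr L) → ClosedUnderInfConj S →
    (S♯ : AbsSemStr S) → StronglyPreserving S S♯ → IsBestCorrectApprox S S♯
theorem5p9 L S cl S♯ sp =
    (λ p → γ≐⇒≈A-α S (I♯-atom p) (γ∘sem♯≐sem S S♯ sp (atom p)))
  , (λ f as → γ≐⇒≈A-α S (I♯-op f as) (γ∘I♯-op≐I-op∘γ S S♯ sp cl f as))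
  where
  open AbsSemStr S♯
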